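{- Let $\mathbf B\in\mathcal V$, let $P$ be a $\mathbf B$-pendant, and let $x\in P|_0$, $y\in P|_1$. Then $h(x,y)\in P|_1$ and $h(y,x)\in P|_1$, where $h(x,y)=f(x,\dots,x,y,\dots,y)$ with $m$ copies of $x$ followed by $m$ copies of $y$.
   Context: Fix a positive integer $m$. Let $\mathcal V$ be the variety whose basic operations are a $2m$-ary symbol $f$ and $m$-ary symbols $g_1,g_2$, axiomatized exactly by idempotence of $f,g_1,g_2$ ($t(x,\dots,x)=x$) and the identities $f(x,\dots,x,y,x,\dots,x)=g_1(x,\dots,x,y,x,\dots,x)$ ($y$ in position $i$ on both sides, $i=1,\dots,m$) and $f(x,\dots,x,y,x,\dots,x)=g_2(x,\dots,x,y,x,\dots,x)$ ($y$ in position $m+i$ on the left and $i$ on the right, $i=1,\dots,m$). Let $\mathbf A$ be the $\mathcal V$-free algebra generated by two elements $0,1$. $R_\omega\le\mathbf A^\omega$ is the subuniverse generated by all $\omega$-sequences having $1$ in exactly one coordinate and $0$ in all others. For $\mathbf B\in\mathcal V$, a $\mathbf B$-pendant is a subuniverse $P\le\mathbf B\times\mathbf A^\omega$ invariant under all permutations of the $\omega$ coordinates of $\mathbf A^\omega$. Set $P|_0=\{b\in B:(b,(0,0,\dots))\in P\}$ and $P|_1=\{b\in B:\exists \bar r\in R_\omega,\ (b,\bar r)\in P\}$. -}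

module Defs where

open import Data.Nat using (ℕ; _+_; _<_)
open import Data.Fin using (Fin; _≟_; _↑ˡ_; _↑ʳ_; splitAt)
open import Data.Bool using (Bool; true; false; if_then_else_)
open import Data.Sum using ([_,_])
open import Data.Product using (_×_; _,_; proj₁; proj₂; ∃)
open import Function using (_∘_; const; _↔_; Inverse)
open import Relation.Nullary using (does)
open import Relation.Binary using (IsEquivalence)

at : ∀ {A : Set} {n : ℕ} → Fin n → A → A → Fin n → A
at i y x j = if does (j ≟ i) then y else x

blocks : ∀ {A : Set} (m : ℕ) → A → A → Fin (m + m) → A
blocks m x y = [ const x , const y ] ∘ splitAt m

record VAlg (m : ℕ) : Set₁ where
  field
    Carrier : Set
    _≈_     : Carrier → Carrier → Set
    isEquiv : IsEquivalence _≈_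
    f       : (Fin (m + m) → Carrier) → Carrier
    g₁      : (Fin m → Carrier) → Carrier
    g₂      : (Fin m → Carrier) → Carrier
    f-cong  : ∀ {a b} → (∀ j → a j ≈ b j) → f a ≈ f b
    g₁-cong : ∀ {a b} → (∀ j → a j ≈ b j) → g₁ a ≈ g₁ b
    g₂-cong : ∀ {a b} → (∀ j → a j ≈ b j) → g₂ a ≈ g₂ b
    f-idem  : ∀ x → f (const x) ≈ x
    g₁-idem : ∀ x → g₁ (const x) ≈ x
    g₂-idem : ∀ x → g₂ (const x) ≈ x
    ax₁     : ∀ (i : Fin m) x y → f (at (i ↑ˡ m) y x) ≈ g₁ (at i y x)
    ax₂     : ∀ (i : Fin m) x y → f (at (m ↑ʳ i) y x) ≈ g₂ (at i y x)

h : ∀ {m} (B : VAlg m) → VAlg.Carrier B → VAlg.Carrier B → VAlg.Carrier B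
h {m} B x y = VAlg.f B (blocks m x y)

-- The V-free algebra A on two generators 0 = var false, 1 = var true:
-- terms modulo the equational theory of V (the least fully invariant
-- congruence containing the axioms).

data Term (m : ℕ) : Set where
  var : Bool → Term m
  fT  : (Fin (m + m) → Term m) → Term m
  g₁T : (Fin m → Term m) → Term m
  g₂T : (Fin m → Term m) → Term m

𝟘 𝟙 : ∀ {m} → Term m
𝟘 = var false
𝟙 = var true

infix 4 _≈T_
data _≈T_ {m : ℕ} : Term m → Term m → Set where
  reflT   : ∀ {s} → s ≈T s
  symT    : ∀ {s t} → s ≈T t → t ≈T s
  transT  : ∀ {s t u} → s ≈T t → t ≈T u → s ≈T u
  f-congT  : ∀ {a b} → (∀ j → a j ≈T b j) → fT a ≈T fT b
  g₁-congT : ∀ {a b} → (∀ j → a j ≈T b j) → g₁T a ≈T g₁T b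
  g₂-congT : ∀ {a b} → (∀ j → a j ≈T b j) → g₂T a ≈T g₂T b
  f-idemT  : ∀ x → fT (const x) ≈T x
  g₁-idemT : ∀ x → g₁T (const x) ≈T x
  g₂-idemT : ∀ x → g₂T (const x) ≈T x
  ax₁T : ∀ (i : Fin m) x y → fT (at (i ↑ˡ m) y x) ≈T g₁T (at i y x)
  ax₂T : ∀ (i : Fin m) x y → fT (at (m ↑ʳ i) y x) ≈T g₂T (at i y x)

Seq : ℕ → Set
Seq m = ℕ → Term m

_≈S_ : ∀ {m} → Seq m → Seq m → Set
r ≈S s = ∀ i → r i ≈T s i

e : ∀ {m} → ℕ → Seq m
e k i = if does (Data.Nat._≟_ i k) then 𝟙 else 𝟘

data Rω {m : ℕ} : Seq m → Set where
  gen  : ∀ k → Rω (e k)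
  resp : ∀ {r s} → r ≈S s → Rω r → Rω s
  f-cl  : (rs : Fin (m + m) → Seq m) → (∀ j → Rω (rs j)) → Rω (λ i → fT (λ j → rs j i))
  g₁-cl : (rs : Fin m → Seq m) → (∀ j → Rω (rs j)) → Rω (λ i → g₁T (λ j → rs j i))
  g₂-cl : (rs : Fin m → Seq m) → (∀ j → Rω (rs j)) → Rω (λ i → g₂T (λ j → rs j i))

record IsPendant {m : ℕ} (B : VAlg m) (P : VAlg.Carrier B × Seq m → Set) : Set₁ where
  open VAlg B
  field
    respects : ∀ {b b' r r'} → b ≈ b' → r ≈S r' → P (b , r) → P (b' , r')
    f-closed  : (ps : Fin (m + m) → Carrier × Seq m) → (∀ j → P (ps j)) →
                P (f (proj₁ ∘ ps) , (λ i → fT (λ j → proj₂ (ps j) i)))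
    g₁-closed : (ps : Fin m → Carrier × Seq m) → (∀ j → P (ps j)) →
                P (g₁ (proj₁ ∘ ps) , (λ i → g₁T (λ j → proj₂ (ps j) i)))
    g₂-closed : (ps : Fin m → Carrier × Seq m) → (∀ j → P (ps j)) →
                P (g₂ (proj₁ ∘ ps) , (λ i → g₂T (λ j → proj₂ (ps j) i)))
    perm-inv  : (σ : ℕ ↔ ℕ) → ∀ {b r} → P (b , r) → P (b , r ∘ Inverse.to σ)

P∣₀ : ∀ {m} {B : VAlg m} → (VAlg.Carrier B × Seq m → Set) → VAlg.Carrier B → Set
P∣₀ P b = P (b , const 𝟘)

P∣₁ : ∀ {m} {B : VAlg m} → (VAlg.Carrier B × Seq m → Set) → VAlg.Carrier B → Set
P∣₁ P b = ∃ λ r → Rω r × P (b , r)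

module Submission where

-- A sequence r ∈ R_ω vanishes beyond some N.  Composing r with the permutation
-- exchanging the blocks [0, jN) and [jN, 2jN) gives m permuted copies r_j of r,
-- supported in the pairwise disjoint blocks [jN, jN + N).  Closing P under f at
-- (x, 0̄), …, (x, 0̄), (y, r_0), …, (y, r_{m-1}) pairs h(x, y) with the sequence
-- f(0, …, 0, r_0(i), …, r_{m-1}(i)); since at most one r_j(i) is nonzero, the
-- identities of V turn each coordinate into g₂(r_0(i), …, r_{m-1}(i)), and this
-- sequence lies in R_ω.  Symmetrically h(y, x) is paired with g₁ of the copies.

open import Defs
open import Data.Nat using (ℕ; _<_)
open import Data.Product using (_×_)

open import Data.Nat as ℕ using (zero; suc; _+_; _*_; _∸_; _⊔_; _≤_; _<?_; z≤n; s≤s⁻¹)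
open import Data.Nat.Properties
open import Data.Fin using (Fin; toℕ; fromℕ<; _↑ʳ_; _↑ˡ_; splitAt)
open import Data.Fin.Properties using (splitAt-↑ʳ; splitAt-↑ˡ; splitAt⁻¹-↑ʳ; splitAt⁻¹-↑ˡ; toℕ-injective; any?)
open import Data.Sum using (inj₁; inj₂; _⊎_; [_,_]; [_,_]′)
open import Data.Sum.Properties using ([,]-∘)
open import Data.Product using (_,_; proj₁; proj₂; ∃-syntax)
open import Data.Bool using (if_then_else_)
open import Function using (_∘_; const; _↔_; Inverse; mk↔ₛ′)
open import Relation.Nullary using (¬_; yes; no; contradiction)
open import Relation.Nullary.Decidable using (dec-true; dec-false)
open import Relation.Binary using (Setoid; IsEquivalence)
open import Relation.Binary.PropositionalEquality using (_≡_; _≢_; refl; sym; trans; cong; subst; module ≡-Reasoning)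
import Relation.Binary.Reasoning.Setoid as SetoidReasoning

termAlgebra : (m : ℕ) → VAlg m
termAlgebra m = record
  { Carrier = Term m ; _≈_ = _≈T_
  ; isEquiv = record { refl = reflT ; sym = symT ; trans = transT }
  ; f = fT ; g₁ = g₁T ; g₂ = g₂T
  ; f-cong = f-congT ; g₁-cong = g₁-congT ; g₂-cong = g₂-congT
  ; f-idem = f-idemT ; g₁-idem = g₁-idemT ; g₂-idem = g₂-idemT
  ; ax₁ = ax₁T ; ax₂ = ax₂T
  }

≈T-reflexive : ∀ {m} {s t : Term m} → s ≡ t → s ≈T t
≈T-reflexive refl = reflT

module _ {m : ℕ} (A : VAlg m) where
  open VAlg A

  private
    setoid : Setoid _ _
    setoid = record { isEquivalence = isEquiv }
    open Setoid setoid using (reflexive) renaming (refl to ≈-refl; sym to ≈-sym)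
    open SetoidReasoning setoid

  ≈-at : ∀ {n} (v : Fin n → Carrier) (i : Fin n) {y z} → v i ≈ y →
         (∀ j → j ≢ i → v j ≈ z) → ∀ j → v j ≈ at i y z j
  ≈-at v i vi≈y others j with j Data.Fin.≟ i
  ... | yes refl = vi≈y
  ... | no j≢i = others j j≢i

  f-single-right : ∀ z (u : Fin m → Carrier) i → (∀ j → j ≢ i → u j ≈ z) →
                   f ([ const z , u ]′ ∘ splitAt m) ≈ g₂ u
  f-single-right z u i others = begin
    f w                       ≈⟨ f-cong (≈-at w (m ↑ʳ i) wi≈ui w-others) ⟩
    f (at (m ↑ʳ i) (u i) z)   ≈⟨ ax₂ i z (u i) ⟩
    g₂ (at i (u i) z)         ≈⟨ ≈-sym (g₂-cong (≈-at u i ≈-refl others)) ⟩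
    g₂ u                      ∎
    where
    w = [ const z , u ]′ ∘ splitAt m
    wi≈ui : w (m ↑ʳ i) ≈ u i
    wi≈ui = reflexive (cong [ const z , u ]′ (splitAt-↑ʳ m m i))
    w-others : ∀ k → k ≢ m ↑ʳ i → w k ≈ z
    w-others k k≢ with splitAt m k in eq
    ... | inj₁ _ = ≈-refl
    ... | inj₂ j = others j λ { refl → k≢ (sym (splitAt⁻¹-↑ʳ eq)) }

  f-single-left : ∀ z (u : Fin m → Carrier) i → (∀ j → j ≢ i → u j ≈ z) →
                  f ([ u , const z ]′ ∘ splitAt m) ≈ g₁ u
  f-single-left z u i others = begin
    f w                       ≈⟨ f-cong (≈-at w (i ↑ˡ m) wi≈ui w-others) ⟩
    f (at (i ↑ˡ m) (u i) z)   ≈⟨ ax₁ i z (u i) ⟩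
    g₁ (at i (u i) z)         ≈⟨ ≈-sym (g₁-cong (≈-at u i ≈-refl others)) ⟩
    g₁ u                      ∎
    where
    w = [ u , const z ]′ ∘ splitAt m
    wi≈ui : w (i ↑ˡ m) ≈ u i
    wi≈ui = reflexive (cong [ u , const z ]′ (splitAt-↑ˡ m i m))
    w-others : ∀ k → k ≢ i ↑ˡ m → w k ≈ z
    w-others k k≢ with splitAt m k in eq
    ... | inj₂ _ = ≈-refl
    ... | inj₁ j = others j λ { refl → k≢ (sym (splitAt⁻¹-↑ˡ eq)) }

module _ {m : ℕ} {B : VAlg m} {P : VAlg.Carrier B × Seq m → Set} (isP : IsPendant B P) where
  open VAlg B
  open IsPendant isP

  f-closed-split : (a b : Fin m → Carrier × Seq m) → (∀ j → P (a j)) → (∀ j → P (b j)) →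
    P ( f ([ proj₁ ∘ a , proj₁ ∘ b ]′ ∘ splitAt m)
      , λ i → fT ([ (λ j → proj₂ (a j) i) , (λ j → proj₂ (b j) i) ]′ ∘ splitAt m))
  f-closed-split a b Pa Pb =
    respects (f-cong λ k → reflexive ([,]-∘ proj₁ {a} {b} (splitAt m k)))
             (λ i → f-congT λ k → ≈T-reflexive ([,]-∘ (λ p → proj₂ p i) {a} {b} (splitAt m k)))
             (f-closed ([ a , b ]′ ∘ splitAt m) ([_,_] {C = λ s → P ([ a , b ]′ s)} Pa Pb ∘ splitAt m))
    where open IsEquivalence isEquiv using (reflexive)

upper-bound : ∀ {n} (g : Fin n → ℕ) → ∃[ N ] (∀ j → g j ≤ N)
upper-bound {zero} g = 0 , λ ()
upper-bound {suc n} g with upper-bound (g ∘ Data.Fin.suc)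
... | N , bounds = g Data.Fin.zero ⊔ N , λ where
  Data.Fin.zero → m≤m⊔n _ N
  (Data.Fin.suc j) → ≤-trans (bounds j) (m≤n⊔m _ N)

EventuallyZero : ∀ {m} → Seq m → Set
EventuallyZero r = ∃[ N ] (∀ i → N ≤ i → r i ≈T 𝟘)

eventuallyZero-op : ∀ {m n} (op : (Fin n → Term m) → Term m) →
  (∀ {a b} → (∀ j → a j ≈T b j) → op a ≈T op b) → op (const 𝟘) ≈T 𝟘 →
  (rs : Fin n → Seq m) → (∀ j → EventuallyZero (rs j)) →
  EventuallyZero (λ i → op (λ j → rs j i))
eventuallyZero-op op op-cong op-idem rs rs-ez with upper-bound (proj₁ ∘ rs-ez)
... | N , bounds = N , λ i N≤i →
  transT (op-cong λ j → proj₂ (rs-ez j) i (≤-trans (bounds j) N≤i)) op-idem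

e-on : ∀ {m} {k i} → i ≡ k → e {m} k i ≡ 𝟙
e-on {k = k} {i} i≡k = cong (if_then 𝟙 else 𝟘) (dec-true (i ℕ.≟ k) i≡k)

e-off : ∀ {m} {k i} → i ≢ k → e {m} k i ≡ 𝟘
e-off {k = k} {i} i≢k = cong (if_then 𝟙 else 𝟘) (dec-false (i ℕ.≟ k) i≢k)

Rω-eventuallyZero : ∀ {m} {r : Seq m} → Rω r → EventuallyZero r
Rω-eventuallyZero (gen k) = suc k , λ i k<i → ≈T-reflexive (e-off λ i≡k → <-irrefl (sym i≡k) k<i)
Rω-eventuallyZero (resp r≈s r∈R) with Rω-eventuallyZero r∈R
... | N , vanish = N , λ i N≤i → transT (symT (r≈s i)) (vanish i N≤i)
Rω-eventuallyZero (f-cl rs rs∈R) = eventuallyZero-op fT f-congT (f-idemT 𝟘) rs (Rω-eventuallyZero ∘ rs∈R)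
Rω-eventuallyZero (g₁-cl rs rs∈R) = eventuallyZero-op g₁T g₁-congT (g₁-idemT 𝟘) rs (Rω-eventuallyZero ∘ rs∈R)
Rω-eventuallyZero (g₂-cl rs rs∈R) = eventuallyZero-op g₂T g₂-congT (g₂-idemT 𝟘) rs (Rω-eventuallyZero ∘ rs∈R)

module _ (π : ℕ ↔ ℕ) where
  open Inverse π

  e-∘ : ∀ {m} k i → e {m} (from k) i ≈T e k (to i)
  e-∘ k i with i ℕ.≟ from k
  ... | yes i≡k′ = ≈T-reflexive (trans (e-on i≡k′) (sym (e-on (trans (cong to i≡k′) (strictlyInverseˡ k)))))
  ... | no i≢k′ = ≈T-reflexive (trans (e-off i≢k′) (sym (e-off λ to-i≡k →
                    i≢k′ (trans (sym (strictlyInverseʳ i)) (cong from to-i≡k)))))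

  Rω-∘ : ∀ {m} {r : Seq m} → Rω r → Rω (r ∘ to)
  Rω-∘ (gen k) = resp (e-∘ k) (gen (from k))
  Rω-∘ (resp r≈s r∈R) = resp (r≈s ∘ to) (Rω-∘ r∈R)
  Rω-∘ (f-cl rs rs∈R) = f-cl (λ j → rs j ∘ to) (Rω-∘ ∘ rs∈R)
  Rω-∘ (g₁-cl rs rs∈R) = g₁-cl (λ j → rs j ∘ to) (Rω-∘ ∘ rs∈R)
  Rω-∘ (g₂-cl rs rs∈R) = g₂-cl (λ j → rs j ∘ to) (Rω-∘ ∘ rs∈R)

swapBlocks : ℕ → ℕ → ℕ
swapBlocks c i with i <? c | i <? c + c
... | yes _ | _     = i + c
... | no _  | yes _ = i ∸ c
... | no _  | no _  = i

swapBlocks-lower : ∀ {c i} → i < c → swapBlocks c i ≡ i + c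
swapBlocks-lower {c} {i} i<c with i <? c | i <? c + c
... | yes _   | _ = refl
... | no i≮c  | _ = contradiction i<c i≮c

swapBlocks-upper : ∀ {c i} → c ≤ i → i < c + c → swapBlocks c i ≡ i ∸ c
swapBlocks-upper {c} {i} c≤i i<2c with i <? c | i <? c + c
... | yes i<c | _          = contradiction c≤i (<⇒≱ i<c)
... | no _    | yes _      = refl
... | no _    | no i≮2c    = contradiction i<2c i≮2c

swapBlocks-beyond : ∀ {c i} → ¬ i < c + c → swapBlocks c i ≡ i
swapBlocks-beyond {c} {i} i≮2c with i <? c | i <? c + c
... | yes i<c | _       = contradiction (≤-trans i<c (m≤m+n c c)) i≮2c
... | no _    | yes i<2c = contradiction i<2c i≮2c
... | no _    | no _    = refl

swapBlocks-involutive : ∀ c i → swapBlocks c (swapBlocks c i) ≡ i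
swapBlocks-involutive c i with i <? c | i <? c + c
... | yes i<c | _ = begin
  swapBlocks c (i + c)  ≡⟨ swapBlocks-upper (m≤n+m c i) (+-monoˡ-< c i<c) ⟩
  i + c ∸ c             ≡⟨ m+n∸n≡m i c ⟩
  i                     ∎
  where open ≡-Reasoning
... | no i≮c | yes i<2c = begin
  swapBlocks c (i ∸ c)  ≡⟨ swapBlocks-lower (+-cancelʳ-< c (i ∸ c) c i∸c+c<2c) ⟩
  i ∸ c + c             ≡⟨ m∸n+n≡m (≮⇒≥ i≮c) ⟩
  i                     ∎
  where
  open ≡-Reasoning
  i∸c+c<2c : i ∸ c + c < c + c
  i∸c+c<2c = subst (_< c + c) (sym (m∸n+n≡m (≮⇒≥ i≮c))) i<2c
... | no _ | no i≮2c = swapBlocks-beyond {c} {i} i≮2c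

swapBlocks↔ : ℕ → ℕ ↔ ℕ
swapBlocks↔ c = mk↔ₛ′ (swapBlocks c) (swapBlocks c) (swapBlocks-involutive c) (swapBlocks-involutive c)

swapBlocks-< : ∀ {c d i} → c ≡ 0 ⊎ d ≤ c → swapBlocks c i < d → c ≤ i × i < d + c
swapBlocks-< {c} {d} {i} c≡0⊎d≤c lt with i <? c | i <? c + c | c≡0⊎d≤c
... | yes i<c | _ | inj₁ refl = contradiction i<c λ ()
... | yes _   | _ | inj₂ d≤c = contradiction (<-≤-trans lt d≤c) (≤⇒≯ (m≤n+m c i))
... | no i≮c  | yes _ | _ = c≤i , subst (_< d + c) (m∸n+n≡m c≤i) (+-monoˡ-< c lt)
  where c≤i = ≮⇒≥ i≮c
... | no _ | no _ | inj₁ refl = z≤n , <-≤-trans lt (m≤m+n d 0)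
... | no _ | no i≮2c | inj₂ d≤c = contradiction (≤-trans (m≤m+n c c) (≮⇒≥ i≮2c)) (<⇒≱ (<-≤-trans lt d≤c))

block-unique : ∀ {N a b i} → a * N ≤ i → i < N + a * N → b * N ≤ i → i < N + b * N → a ≡ b
block-unique {N} {a} {b} a≤ <a b≤ <b = ≤-antisym (below a≤ <b) (below b≤ <a)
  where
  below : ∀ {x y i} → x * N ≤ i → i < N + y * N → x ≤ y
  below {x} {y} x≤ <y = s≤s⁻¹ (*-cancelʳ-< N x (suc y) (≤-<-trans x≤ <y))

module Copies {m : ℕ} (r : Seq m) (N : ℕ) (r-vanishes : ∀ i → N ≤ i → r i ≈T 𝟘) where

  shift : Fin m → ℕ ↔ ℕ
  shift j = swapBlocks↔ (toℕ j * N)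

  copy : Fin m → Seq m
  copy j = r ∘ Inverse.to (shift j)

  copy-block : ∀ (j : Fin m) i → swapBlocks (toℕ j * N) i < N → toℕ j * N ≤ i × i < N + toℕ j * N
  copy-block j i = swapBlocks-< (small (toℕ j))
    where
    small : ∀ a → a * N ≡ 0 ⊎ N ≤ a * N
    small zero = inj₁ refl
    small (suc a) = inj₂ (m≤m+n N (a * N))

  copy-unique : ∀ i {j j′ : Fin m} → swapBlocks (toℕ j * N) i < N → swapBlocks (toℕ j′ * N) i < N → j ≡ j′
  copy-unique i {j} {j′} lt lt′ with copy-block j i lt | copy-block j′ i lt′
  ... | lo , hi | lo′ , hi′ = toℕ-injective (block-unique lo hi lo′ hi′)

  copy-vanishes : ∀ (j : Fin m) i → ¬ swapBlocks (toℕ j * N) i < N → copy j i ≈T 𝟘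
  copy-vanishes j i ≮N = r-vanishes _ (≮⇒≥ ≮N)

  copies-isolated : 0 < m → ∀ i → ∃[ j₀ ] (∀ j → j ≢ j₀ → copy j i ≈T 𝟘)
  copies-isolated 0<m i with any? (λ (j : Fin m) → swapBlocks (toℕ j * N) i <? N)
  ... | no none = fromℕ< 0<m , λ j _ → copy-vanishes j i λ lt → none (j , lt)
  ... | yes (j₀ , lt₀) = j₀ , others
    where
    others : ∀ j → j ≢ j₀ → copy j i ≈T 𝟘
    others j j≢j₀ with swapBlocks (toℕ j * N) i <? N
    ... | yes lt = contradiction (copy-unique i lt lt₀) j≢j₀
    ... | no ≮N = copy-vanishes j i ≮N

mainTheorem7 : (m : ℕ) → 0 < m → (B : VAlg m) →
    (P : VAlg.Carrier B × Seq m → Set) → IsPendant B P →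
    (x y : VAlg.Carrier B) → P∣₀ {B = B} P x → P∣₁ {B = B} P y →
    P∣₁ {B = B} P (h B x y) × P∣₁ {B = B} P (h B y x)
mainTheorem7 m 0<m B P isP x y Px (r , r∈R , Pyr) with Rω-eventuallyZero r∈R
... | N , r-vanishes =
    ( (λ i → g₂T (λ j → copy j i)) , g₂-cl copy copies∈R
    , respects ≈-refl (λ i → f-single-right (termAlgebra m) 𝟘 _ _ (proj₂ (copies-isolated 0<m i)))
        (f-closed-split isP (const (x , const 𝟘)) yCopies (const Px) yCopies∈P) )
  , ( (λ i → g₁T (λ j → copy j i)) , g₁-cl copy copies∈R
    , respects ≈-refl (λ i → f-single-left (termAlgebra m) 𝟘 _ _ (proj₂ (copies-isolated 0<m i)))
        (f-closed-split isP yCopies (const (x , const 𝟘)) yCopies∈P (const Px)) )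
  where
  open Copies r N r-vanishes
  open IsPendant isP
  open IsEquivalence (VAlg.isEquiv B) renaming (refl to ≈-refl)

  copies∈R : ∀ j → Rω (copy j)
  copies∈R j = Rω-∘ (shift j) r∈R

  yCopies : Fin m → VAlg.Carrier B × Seq m
  yCopies j = y , copy j

  yCopies∈P : ∀ j → P (yCopies j)
  yCopies∈P j = perm-inv (shift j) Pyr
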